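{- Let $h(x)=\sum_{k\ge1}h_kx^k\in\mathbb{K}[[x]]$ with $h_k\ne0$ for all $k\ge1$, let $q\in\mathbb{K}[[x]]$, $y_0\in\mathbb{K}$, and let $T:\mathbb{K}[[x]]\to\mathbb{K}[[x]]$ be a non-expansive $\mathbb{K}$-linear endomorphism. Then the problem $\mathcal{D}_h(y)=T(y)+q$, $y(0)=y_0$, has a unique solution $y\in\mathbb{K}[[x]]$, given by $$y=\frac{1}{1-x}(\mathcal{I}_h\circ T)\big(y_0+\mathcal{I}_h(q)\big)=\sum_{k\ge0}(\mathcal{I}_h\circ T)^k\big(y_0+\mathcal{I}_h(q)\big).$$
   Context: $\mathbb{K}$ is a field of characteristic zero; on $\mathbb{K}[[x]]$, $d(f,g)=2^{ -\omega(f-g)}$ where $\omega$ is the order (index of the first nonzero coefficient), $d(f,f)=0$. Non-expansive means $d(T(f),T(g))\le d(f,g)$. The $h$-derivative is $\mathcal{D}_h\big(\sum_{k\ge0}s_kx^k\big)=\sum_{k\ge1}h_ks_kx^{k-1}$ and the $h$-integral is $\mathcal{I}_h\big(\sum_{k\ge0}s_kx^k\big)=\sum_{k\ge0}\frac{s_k}{h_{k+1}}x^{k+1}$. For a power series $f=\sum f_nx^n$ and a contractive linear operator $S$ (i.e. $c$-Lipschitz for $d$ with $c<1$), $f(S)=\sum_{n\ge0}f_nS^n$, the series converging in $d$; here $S=\mathcal{I}_h\circ T$ is contractive and $\frac{1}{1-x}(S)=\sum_{k\ge0}S^k$. -}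

module Defs where

open import Level using (Level; _⊔_; suc)
open import Data.Nat using (ℕ; zero; _<_; _≤_) renaming (suc to sucℕ)
open import Data.Product using (Σ; ∃; _×_; _,_)
open import Relation.Nullary using (¬_)
open import Algebra.Bundles using (CommutativeRing)

record Field (c ℓ : Level) : Set (suc (c ⊔ ℓ)) where
  field
    commutativeRing : CommutativeRing c ℓ
  open CommutativeRing commutativeRing public
  field
    1≉0   : ¬ (1# ≈ 0#)
    inv   : (x : Carrier) → ¬ (x ≈ 0#) → Carrier
    inv-r : (x : Carrier) (p : ¬ (x ≈ 0#)) → (x * inv x p) ≈ 1#

module _ {c ℓ : Level} (F : Field c ℓ) where
  open Field F using (Carrier; _≈_; _+_; _*_; 0#; 1#; inv)

  natK : ℕ → Carrier
  natK zero = 0#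
  natK (sucℕ n) = 1# + natK n

  CharZero : Set ℓ
  CharZero = (n : ℕ) → ¬ (natK (sucℕ n) ≈ 0#)

  PS : Set c
  PS = ℕ → Carrier

  _≈ₚ_ : PS → PS → Set ℓ
  f ≈ₚ g = (n : ℕ) → f n ≈ g n

  _+ₚ_ : PS → PS → PS
  (f +ₚ g) n = f n + g n

  _•ₚ_ : Carrier → PS → PS
  (a •ₚ f) n = a * f n

  0ₚ : PS
  0ₚ n = 0#

  constₚ : Carrier → PS
  constₚ a zero = a
  constₚ a (sucℕ n) = 0#

  -- f and g agree on all coefficients of index < n,
  -- i.e. ω(f - g) ≥ n, i.e. d(f,g) ≤ 2^{-n}
  AgreeBelow : ℕ → PS → PS → Set ℓ
  AgreeBelow n f g = (i : ℕ) → i < n → f i ≈ g i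

  Linear : (PS → PS) → Set (c ⊔ ℓ)
  Linear T = ((f g : PS) → T (f +ₚ g) ≈ₚ (T f +ₚ T g))
           × ((a : Carrier) (f : PS) → T (a •ₚ f) ≈ₚ (a •ₚ T f))

  -- non-expansive: d(T f, T g) ≤ d(f, g), written out via ω:
  -- whenever ω(f - g) ≥ n we have ω(T f - T g) ≥ n
  NonExpansive : (PS → PS) → Set (c ⊔ ℓ)
  NonExpansive T = (n : ℕ) (f g : PS) → AgreeBelow n f g → AgreeBelow n (T f) (T g)

  ConvergesTo : (ℕ → PS) → PS → Set ℓ
  ConvergesTo s y = (n : ℕ) → ∃ λ N → (M : ℕ) → N ≤ M → AgreeBelow n (s M) y

  module _ (h : PS) (hnz : (k : ℕ) → ¬ (h (sucℕ k) ≈ 0#)) where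

    Dh : PS → PS
    Dh s k = h (sucℕ k) * s (sucℕ k)

    Ih : PS → PS
    Ih s zero = 0#
    Ih s (sucℕ k) = s k * inv (h (sucℕ k)) (hnz k)

    Spow : (PS → PS) → ℕ → PS → PS
    Spow T zero u = u
    Spow T (sucℕ k) u = Ih (T (Spow T k u))

    partialSums : (PS → PS) → PS → ℕ → PS
    partialSums T u zero = 0ₚ
    partialSums T u (sucℕ N) = partialSums T u N +ₚ Spow T N u

    Solves : (PS → PS) → PS → Carrier → PS → Set ℓ
    Solves T q y0 y = (Dh y ≈ₚ (T y +ₚ q)) × (y zero ≈ y0)

{-# OPTIONS --safe #-}
module Submission where

-- Writing u = y₀ + I_h(q) and S = I_h ∘ T, the problem D_h y = T y + q,
-- y(0) = y₀ is equivalent to the fixed-point equation y = Φ y with Φ f = u + S f,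
-- because I_h is a right inverse of D_h and a series is determined by D_h and its
-- constant term. Since I_h shifts coefficients up by one and T is non-expansive,
-- Φ is a contraction of the ultrametric d. Hence Φ has at most one fixed point, and
-- the iterates Φᴺ(0), which are exactly the partial sums Σ_{k<N} Sᵏ u, agree below
-- x^N with all later ones; their coefficientwise limit is therefore a fixed point.

open import Defs
open import Level using (Level; _⊔_)
open import Data.Nat using (ℕ; zero; _≤′_; ≤′-refl; ≤′-step; s≤s) renaming (suc to sucℕ)
open import Data.Nat.Properties using (n<1+n; ≤⇒≤′; ≤′⇒≤; ≤-trans)
open import Data.Product using (Σ; _×_; _,_; proj₁)
open import Relation.Nullary using (¬_)
import Algebra.Properties.CommutativeSemigroup as CommutativeSemigroupProperties
import Relation.Binary.Reasoning.Setoid as SetoidReasoning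

module _ {c ℓ : Level} (F : Field c ℓ) where

  open Field F hiding (zero)
  open SetoidReasoning setoid
  open CommutativeSemigroupProperties +-commutativeSemigroup using (x∙yz≈xz∙y)

  [x*a]*x⁻¹≈a : (x : Carrier) (x≉0 : ¬ (x ≈ 0#)) (a : Carrier) → (x * a) * inv x x≉0 ≈ a
  [x*a]*x⁻¹≈a x x≉0 a = begin
    (x * a) * inv x x≉0   ≈⟨ *-congʳ (*-comm x a) ⟩
    (a * x) * inv x x≉0   ≈⟨ *-assoc a x _ ⟩
    a * (x * inv x x≉0)   ≈⟨ *-congˡ (inv-r x x≉0) ⟩
    a * 1#                ≈⟨ *-identityʳ a ⟩
    a                     ∎

  x*[a*x⁻¹]≈a : (x : Carrier) (x≉0 : ¬ (x ≈ 0#)) (a : Carrier) → x * (a * inv x x≉0) ≈ a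
  x*[a*x⁻¹]≈a x x≉0 a = trans (sym (*-assoc x a _)) ([x*a]*x⁻¹≈a x x≉0 a)

  nonExpansive⇒cong : {T : PS F → PS F} → NonExpansive F T →
                      {f g : PS F} → _≈ₚ_ F f g → _≈ₚ_ F (T f) (T g)
  nonExpansive⇒cong ne {f} {g} f≈g i = ne (sucℕ i) f g (λ j _ → f≈g j) i (n<1+n i)

  linear⇒T0≈0 : {T : PS F → PS F} → Linear F T → NonExpansive F T → _≈ₚ_ F (T (0ₚ F)) (0ₚ F)
  linear⇒T0≈0 {T} (_ , homogeneous) ne i = begin
    T (0ₚ F) i              ≈⟨ nonExpansive⇒cong ne (λ _ → sym (zeroˡ 0#)) i ⟩
    T (_•ₚ_ F 0# (0ₚ F)) i  ≈⟨ homogeneous 0# (0ₚ F) i ⟩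
    0# * T (0ₚ F) i         ≈⟨ zeroˡ _ ⟩
    0#                      ∎

  Contractive : (PS F → PS F) → Set (c ⊔ ℓ)
  Contractive Φ = (n : ℕ) (f g : PS F) → AgreeBelow F n f g → AgreeBelow F (sucℕ n) (Φ f) (Φ g)

  module FixedPoint (Φ : PS F → PS F) (contractive : Contractive Φ) where

    fixedPoint-unique : {f g : PS F} → _≈ₚ_ F f (Φ f) → _≈ₚ_ F g (Φ g) → _≈ₚ_ F f g
    fixedPoint-unique {f} {g} f≈Φf g≈Φg i = agreeBelow (sucℕ i) i (n<1+n i)
      where
      agreeBelow : (n : ℕ) → AgreeBelow F n f g
      agreeBelow zero _ ()
      agreeBelow (sucℕ n) i i<1+n =
        trans (f≈Φf i) (trans (contractive n f g (agreeBelow n) i i<1+n) (sym (g≈Φg i)))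

    module Iterates (x : ℕ → PS F) (x-step : (N : ℕ) → _≈ₚ_ F (x (sucℕ N)) (Φ (x N))) where

      iterates-agree-next : (N : ℕ) → AgreeBelow F N (x N) (x (sucℕ N))
      iterates-agree-next zero _ ()
      iterates-agree-next (sucℕ N) i i<1+N = begin
        x (sucℕ N) i          ≈⟨ x-step N i ⟩
        Φ (x N) i             ≈⟨ contractive N (x N) (x (sucℕ N)) (iterates-agree-next N) i i<1+N ⟩
        Φ (x (sucℕ N)) i      ≈⟨ sym (x-step (sucℕ N) i) ⟩
        x (sucℕ (sucℕ N)) i   ∎

      iterates-agree : {N M : ℕ} → N ≤′ M → AgreeBelow F N (x N) (x M)
      iterates-agree ≤′-refl _ _ = refl
      iterates-agree {N} (≤′-step {M} N≤′M) i i<N =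
        trans (iterates-agree N≤′M i i<N)
              (iterates-agree-next M i (≤-trans i<N (≤′⇒≤ N≤′M)))

      limit : PS F
      limit i = x (sucℕ i) i

      iterates-agree-limit : (N : ℕ) → AgreeBelow F N (x N) limit
      iterates-agree-limit N i i<N = sym (iterates-agree (≤⇒≤′ i<N) i (n<1+n i))

      iterates-converge : ConvergesTo F x limit
      iterates-converge n = n , λ M n≤M i i<n → iterates-agree-limit M i (≤-trans i<n n≤M)

      limit-fixedPoint : _≈ₚ_ F limit (Φ limit)
      limit-fixedPoint i =
        trans (x-step i i) (contractive i (x i) limit (iterates-agree-limit i) i (n<1+n i))

  module _ (h : PS F) (hnz : (k : ℕ) → ¬ (h (sucℕ k) ≈ 0#)) where

    private
      ∫ : PS F → PS F
      ∫ = Ih F h hnz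

      h⁻¹ : ℕ → Carrier
      h⁻¹ k = inv (h (sucℕ k)) (hnz k)

    Ih-cong : {f g : PS F} → _≈ₚ_ F f g → _≈ₚ_ F (∫ f) (∫ g)
    Ih-cong _   zero     = refl
    Ih-cong f≈g (sucℕ k) = *-congʳ (f≈g k)

    Ih-0 : _≈ₚ_ F (∫ (0ₚ F)) (0ₚ F)
    Ih-0 zero     = refl
    Ih-0 (sucℕ k) = zeroˡ _

    Ih-+ : (f g : PS F) → _≈ₚ_ F (∫ (_+ₚ_ F f g)) (_+ₚ_ F (∫ f) (∫ g))
    Ih-+ _ _ zero     = sym (+-identityʳ 0#)
    Ih-+ _ _ (sucℕ k) = distribʳ _ _ _

    Ih-agreeBelow : (n : ℕ) (f g : PS F) → AgreeBelow F n f g → AgreeBelow F (sucℕ n) (∫ f) (∫ g)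
    Ih-agreeBelow _ _ _ _   zero     _           = refl
    Ih-agreeBelow n f g f≈g (sucℕ i) (s≤s i<n) = *-congʳ (f≈g i i<n)

    Dh-initial⇒integral : {y g : PS F} {a : Carrier} → _≈ₚ_ F (Dh F h hnz y) g → y zero ≈ a →
                          _≈ₚ_ F y (_+ₚ_ F (constₚ F a) (∫ g))
    Dh-initial⇒integral Dy≈g y0≈a zero = trans y0≈a (sym (+-identityʳ _))
    Dh-initial⇒integral {y} {g} Dy≈g y0≈a (sucℕ k) = begin
      y (sucℕ k)                         ≈⟨ sym ([x*a]*x⁻¹≈a (h (sucℕ k)) (hnz k) (y (sucℕ k))) ⟩
      (h (sucℕ k) * y (sucℕ k)) * h⁻¹ k  ≈⟨ *-congʳ (Dy≈g k) ⟩
      g k * h⁻¹ k                        ≈⟨ sym (+-identityˡ _) ⟩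
      0# + g k * h⁻¹ k                   ∎

    integral⇒Dh-initial : {y g : PS F} {a : Carrier} → _≈ₚ_ F y (_+ₚ_ F (constₚ F a) (∫ g)) →
                          _≈ₚ_ F (Dh F h hnz y) g × y zero ≈ a
    integral⇒Dh-initial {y} {g} y≈a+∫g = Dy≈g , trans (y≈a+∫g zero) (+-identityʳ _)
      where
      Dy≈g : _≈ₚ_ F (Dh F h hnz y) g
      Dy≈g k = begin
        h (sucℕ k) * y (sucℕ k)             ≈⟨ *-congˡ (y≈a+∫g (sucℕ k)) ⟩
        h (sucℕ k) * (0# + g k * h⁻¹ k)     ≈⟨ *-congˡ (+-identityˡ _) ⟩
        h (sucℕ k) * (g k * h⁻¹ k)          ≈⟨ x*[a*x⁻¹]≈a (h (sucℕ k)) (hnz k) (g k) ⟩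
        g k                                 ∎

    module InitialValueProblem (T : PS F → PS F) (linear : Linear F T) (nonExpansive : NonExpansive F T)
                               (q : PS F) (y0 : Carrier) where

      S : PS F → PS F
      S f = ∫ (T f)

      u : PS F
      u = _+ₚ_ F (constₚ F y0) (∫ q)

      Φ : PS F → PS F
      Φ f = _+ₚ_ F u (S f)

      S-+ : (f g : PS F) → _≈ₚ_ F (S (_+ₚ_ F f g)) (_+ₚ_ F (S f) (S g))
      S-+ f g i = trans (Ih-cong (proj₁ linear f g) i) (Ih-+ (T f) (T g) i)

      S-0 : _≈ₚ_ F (S (0ₚ F)) (0ₚ F)
      S-0 i = trans (Ih-cong (linear⇒T0≈0 linear nonExpansive) i) (Ih-0 i)

      Φ-contractive : Contractive Φ
      Φ-contractive n f g f≈g i i<1+n =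
        +-congˡ (Ih-agreeBelow n (T f) (T g) (nonExpansive n f g f≈g) i i<1+n)

      partialSums-step : (N : ℕ) → _≈ₚ_ F (partialSums F h hnz T u (sucℕ N)) (Φ (partialSums F h hnz T u N))
      partialSums-step zero i = trans (+-identityˡ _) (sym (trans (+-congˡ (S-0 i)) (+-identityʳ _)))
      partialSums-step (sucℕ N) i = begin
        P (sucℕ N) i + S (Sᴺu) i        ≈⟨ +-congʳ (partialSums-step N i) ⟩
        (u i + S (P N) i) + S (Sᴺu) i   ≈⟨ +-assoc _ _ _ ⟩
        u i + (S (P N) i + S (Sᴺu) i)   ≈⟨ +-congˡ (sym (S-+ (P N) (Sᴺu) i)) ⟩
        u i + S (P (sucℕ N)) i          ∎
        where
        P : ℕ → PS F
        P = partialSums F h hnz T u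
        Sᴺu : PS F
        Sᴺu = Spow F h hnz T N u

      integral-≈Φ : (y : PS F) → _≈ₚ_ F (_+ₚ_ F (constₚ F y0) (∫ (_+ₚ_ F (T y) q))) (Φ y)
      integral-≈Φ y i = begin
        constₚ F y0 i + ∫ (_+ₚ_ F (T y) q) i  ≈⟨ +-congˡ (Ih-+ (T y) q i) ⟩
        constₚ F y0 i + (S y i + ∫ q i)        ≈⟨ x∙yz≈xz∙y _ _ _ ⟩
        (constₚ F y0 i + ∫ q i) + S y i        ∎

      solves⇒fixedPoint : {y : PS F} → Solves F h hnz T q y0 y → _≈ₚ_ F y (Φ y)
      solves⇒fixedPoint {y} (Dy≈Ty+q , y0≈) i = trans (Dh-initial⇒integral {y} Dy≈Ty+q y0≈ i) (integral-≈Φ y i)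

      fixedPoint⇒solves : {y : PS F} → _≈ₚ_ F y (Φ y) → Solves F h hnz T q y0 y
      fixedPoint⇒solves {y} y≈Φy = integral⇒Dh-initial (λ i → trans (y≈Φy i) (sym (integral-≈Φ y i)))

      open FixedPoint Φ Φ-contractive public
      open Iterates (partialSums F h hnz T u) partialSums-step public

mainTheorem5 : {c ℓ : Level} (F : Field c ℓ) → CharZero F →
    (h : PS F) → Field._≈_ F (h zero) (Field.0# F) →
    (hnz : (k : ℕ) → ¬ (Field._≈_ F (h (sucℕ k)) (Field.0# F))) →
    (q : PS F) (y0 : Field.Carrier F) (T : PS F → PS F) →
    Linear F T → NonExpansive F T →
    Σ (PS F) λ y →
      Solves F h hnz T q y0 y
      × ConvergesTo F (partialSums F h hnz T (_+ₚ_ F (constₚ F y0) (Ih F h hnz q))) y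
      × ((z : PS F) → Solves F h hnz T q y0 z → _≈ₚ_ F z y)
mainTheorem5 F _ h _ hnz q y0 T linear nonExpansive =
  limit , fixedPoint⇒solves limit-fixedPoint , iterates-converge ,
  λ z z-solves → fixedPoint-unique (solves⇒fixedPoint z-solves) limit-fixedPoint
  where open InitialValueProblem F h hnz T linear nonExpansive q y0
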